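{- The graph $C_n+P_m$ admits a $1$-super graceful labeling in which all vertices receive odd labels if (i) $n=3$ and $m\ge 4$, or (ii) $n=4$ and $m\ge 3$.
   Context: $C_n$ is the cycle on $n$ vertices, $P_m$ is the path on $m$ vertices, and $G+H$ denotes the disjoint union of graphs $G$ and $H$. For integers $a\le b$, $[a,b]$ is the set of integers between $a$ and $b$ inclusive. For $k\ge 1$, a $k$-super graceful labeling of a graph $G=(V,E)$ with $p$ vertices and $q$ edges is a bijection $f:V\cup E\to[k,k+p+q-1]$ with $f(uv)=|f(u)-f(v)|$ for every edge $uv$. -}

module Defs where

open import Data.Nat using (ℕ; zero; suc; _+_; _∸_; _≤_; ∣_-_∣; NonZero)
open import Data.Nat.DivMod using (_mod_; _%_)
open import Data.Fin using (Fin; toℕ; inject₁; _↑ˡ_; _↑ʳ_)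
open import Data.Fin.Base using () renaming (suc to fsuc)
open import Data.List using (List; length; lookup; map; tabulate; _++_)
open import Data.Product using (_×_; _,_; Σ; proj₁; proj₂)
open import Data.Sum using (_⊎_; inj₁; inj₂)
open import Relation.Binary.PropositionalEquality using (_≡_)
open import Function.Definitions using (Injective)

record Graph : Set where
  field
    V : ℕ
    E : List (Fin V × Fin V)

open Graph public

nE : Graph → ℕ
nE G = length (E G)

edge : (G : Graph) → Fin (nE G) → Fin (V G) × Fin (V G)
edge G i = lookup (E G) i

Elem : Graph → Set
Elem G = Fin (V G) ⊎ Fin (nE G)

record IsSuperGraceful (k : ℕ) (G : Graph) (f : Elem G → ℕ) : Set where
  field
    edge-label : ∀ (e : Fin (nE G)) →
      f (inj₂ e) ≡ ∣ f (inj₁ (proj₁ (edge G e))) - f (inj₁ (proj₂ (edge G e))) ∣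
    lower     : ∀ x → k ≤ f x
    upper     : ∀ x → f x ≤ k + V G + nE G ∸ 1
    injective : Injective _≡_ _≡_ f
    surjective : ∀ (j : ℕ) → k ≤ j → j ≤ k + V G + nE G ∸ 1 → Σ (Elem G) (λ x → f x ≡ j)

cycle : (n : ℕ) → .{{NonZero n}} → Graph
cycle n = record { V = n ; E = tabulate (λ (i : Fin n) → (i , (suc (toℕ i)) mod n)) }

path : ℕ → Graph
path zero    = record { V = zero ; E = Data.List.[] }
path (suc m) = record { V = suc m ; E = tabulate (λ (i : Fin m) → (inject₁ i , fsuc i)) }

_⊕_ : Graph → Graph → Graph
G ⊕ H = record
  { V = V G + V H
  ; E = map (λ e → (proj₁ e ↑ˡ V H , proj₂ e ↑ˡ V H)) (E G)
     ++ map (λ e → (V G ↑ʳ proj₁ e , V G ↑ʳ proj₂ e)) (E H) }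

Odd : ℕ → Set
Odd x = x % 2 ≡ 1

HasOddVertexSuperGraceful : ℕ → Graph → Set
HasOddVertexSuperGraceful k G =
  Σ (Elem G → ℕ) (λ f → IsSuperGraceful k G f × (∀ (v : Fin (V G)) → Odd (f (inj₁ v))))

module Submission where

-- Write q for the number of edges.  C_n + P_m has q + 1 vertices, so its 1-super graceful
-- labelings with odd vertex labels come from graceful labelings g whose vertex labels are
-- exactly [0, q]: put 2·g(v) + 1 on the vertices, then the edges carry 2·|g(u) - g(v)|,
-- which are the even numbers in [2, 2q].  This doubling step holds for every graph with
-- q + 1 vertices (graceful⇒oddSuperGraceful); the needed injectivity comes for free from
-- surjectivity by finite counting (bounded-onto⇒injective).
--
-- Graceful labelings of C_n + P_m are handled through the positions 0, …, t (t = q): the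
-- cycle first, then the path.  A graceful labeling of size t in which the first path vertex
-- gets label 1 extends to size t + 3 (extension): reflect every old label x to t + 2 - x and
-- insert the path vertices 1, t + 3, 0 right after the cycle; the old edges keep their
-- differences and the new edges supply t + 1, t + 2, t + 3.  Hence three explicit labelings
-- of consecutive sizes, checked by computation, yield all larger sizes, for n = 3 and n = 4.

open import Defs
open import Data.Nat using (ℕ; zero; suc; _+_; _*_; _∸_; _≤_; _<_; z≤n; s≤s; s≤s⁻¹; ∣_-_∣; NonZero; _%_; _<?_; _≟_)
open import Data.Nat.Properties
open import Data.Nat.DivMod using (m%n<n; [m+kn]%n≡m%n; _mod_)
open import Data.List using (List; []; _∷_; length; lookup; map; tabulate; _++_)
open import Data.List.Properties using (length-map; length-++; length-tabulate)
open import Data.Fin as Fin using (Fin; toℕ; fromℕ<; punchOut; inject₁; _↑ˡ_; _↑ʳ_)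
open import Data.Fin.Properties
  using (toℕ-fromℕ<; toℕ-injective; toℕ<n; injective⇒≤; punchOut-injective; toℕ-↑ˡ; toℕ-↑ʳ; toℕ-inject₁)
open import Data.Product using (_×_; _,_; Σ; ∃; proj₁; proj₂)
open import Data.Sum using (_⊎_; inj₁; inj₂)
open import Function using (_∘_)
open import Function.Definitions using (Injective)
open import Relation.Binary.PropositionalEquality
open import Relation.Nullary using (Dec; yes; no)
open import Relation.Nullary.Decidable using (True; toWitness; map′; _×-dec_)
open import Relation.Nullary.Negation using (contradiction)

-- A surjective self-map of a finite set is injective: if F i ≡ F j with i ≢ j, a section of
-- F chosen to avoid j would inject Fin (suc n) into Fin n.
onto⇒injective : ∀ {n} (F : Fin n → Fin n) → (∀ y → ∃ λ x → F x ≡ y) → Injective _≡_ _≡_ F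
onto⇒injective {suc n} F onto {i} {j} Fi≡Fj with i Fin.≟ j
... | yes i≡j = i≡j
... | no i≢j = contradiction (injective⇒≤ section-injective) 1+n≰n
  where
    preimage : ∀ y → ∃ λ x → j ≢ x × F x ≡ y
    preimage y with onto y
    ... | x , Fx≡y with j Fin.≟ x
    ...   | yes refl = i , (λ j≡i → i≢j (sym j≡i)) , trans Fi≡Fj Fx≡y
    ...   | no j≢x = x , j≢x , Fx≡y

    avoids : ∀ y → j ≢ proj₁ (preimage y)
    avoids y = proj₁ (proj₂ (preimage y))

    hits : ∀ y → F (proj₁ (preimage y)) ≡ y
    hits y = proj₂ (proj₂ (preimage y))

    section : Fin (suc n) → Fin n
    section y = punchOut (avoids y)

    section-injective : Injective _≡_ _≡_ section
    section-injective {y} {y′} eq =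
      trans (sym (hits y)) (trans (cong F (punchOut-injective (avoids y) (avoids y′) eq)) (hits y′))

bounded-onto⇒injective : ∀ {n} (g : Fin n → ℕ) → (∀ x → g x < n) →
                         (∀ y → y < n → ∃ λ x → g x ≡ y) → Injective _≡_ _≡_ g
bounded-onto⇒injective g bound onto eq =
  onto⇒injective F F-onto (toℕ-injective (trans (toℕ-fromℕ< _) (trans eq (sym (toℕ-fromℕ< _)))))
  where
    F = λ x → fromℕ< (bound x)

    F-onto : ∀ y → ∃ λ x → F x ≡ y
    F-onto y with onto (toℕ y) (toℕ<n y)
    ... | x , gx≡y = x , toℕ-injective (trans (toℕ-fromℕ< _) gx≡y)

data Parity : ℕ → Set where
  even : ∀ h → Parity (h * 2)
  odd  : ∀ h → Parity (suc (h * 2))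

parity : ∀ j → Parity j
parity zero = even 0
parity (suc j) with parity j
... | even h = odd h
... | odd h = even (suc h)

-- even≢odd of the library, in the h * 2 form used by the view.
even≢odd′ : ∀ h k → h * 2 ≢ suc (k * 2)
even≢odd′ h k eq = even≢odd h k (trans (*-comm 2 h) (trans eq (cong suc (*-comm k 2))))

half-≤ : ∀ {h q} → h * 2 ≤ suc (q * 2) → h ≤ q
half-≤ {zero} _ = z≤n
half-≤ {suc h} {zero} (s≤s ())
half-≤ {suc h} {suc q} (s≤s (s≤s le)) = s≤s (half-≤ le)

edgeDiff : (G : Graph) → (Fin (V G) → ℕ) → Fin (nE G) → ℕ
edgeDiff G g e = ∣ g (proj₁ (edge G e)) - g (proj₂ (edge G e)) ∣

-- For
-- a graph with q + 1 vertices this is exactly a graceful labeling (by counting, both maps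
-- are then bijections, see below).
record IsGraceful (G : Graph) (g : Fin (V G) → ℕ) : Set where
  field
    vertex-bound : ∀ v → g v ≤ nE G
    vertex-onto  : ∀ y → y ≤ nE G → ∃ λ v → g v ≡ y
    edge-onto    : ∀ y → 1 ≤ y → y ≤ nE G → ∃ λ e → edgeDiff G g e ≡ y

module _ (G : Graph) (size : V G ≡ suc (nE G)) (g : Fin (V G) → ℕ) (gr : IsGraceful G g) where
  open IsGraceful gr

  private
    q = nE G

  vertex-injective : Injective _≡_ _≡_ g
  vertex-injective = bounded-onto⇒injective g
    (λ v → subst (g v <_) (sym size) (s≤s (vertex-bound v)))
    (λ y y<p → vertex-onto y (s≤s⁻¹ (subst (y <_) size y<p)))

  edge-bound : ∀ e → edgeDiff G g e ≤ q
  edge-bound e = ≤-trans (∣m-n∣≤m⊔n (g u) (g w)) (⊔-lub (vertex-bound u) (vertex-bound w))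
    where u = proj₁ (edge G e); w = proj₂ (edge G e)

  -- Shifting edge labels down by one maps the q edges onto [0, q), hence injectively.
  shifted-injective : Injective _≡_ _≡_ (λ e → edgeDiff G g e ∸ 1)
  shifted-injective = bounded-onto⇒injective _ bound onto
    where
      bound : ∀ e → edgeDiff G g e ∸ 1 < q
      bound e with edgeDiff G g e | edge-bound e
      ... | zero  | _ = ≤-trans (s≤s z≤n) (toℕ<n e)
      ... | suc d | d<q = d<q

      onto : ∀ y → y < q → ∃ λ e → edgeDiff G g e ∸ 1 ≡ y
      onto y y<q with edge-onto (suc y) (s≤s z≤n) y<q
      ... | e , d≡ = e , cong (_∸ 1) d≡

  edge-injective : Injective _≡_ _≡_ (edgeDiff G g)
  edge-injective eq = shifted-injective (cong (_∸ 1) eq)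

  -- No edge gets difference 0: it would share its shifted label with the edge of difference 1.
  edge-positive : ∀ e → 1 ≤ edgeDiff G g e
  edge-positive e = n≢0⇒n>0 λ d≡0 →
    let (e₁ , d₁≡1) = edge-onto 1 ≤-refl (≤-trans (s≤s z≤n) (toℕ<n e))
        e≡e₁ = shifted-injective (trans (cong (_∸ 1) d≡0) (sym (cong (_∸ 1) d₁≡1)))
    in 0≢1+n (trans (sym d≡0) (trans (cong (edgeDiff G g) e≡e₁) d₁≡1))

  oddLabel : Elem G → ℕ
  oddLabel (inj₁ v) = suc (g v * 2)
  oddLabel (inj₂ e) = ∣ oddLabel (inj₁ (proj₁ (edge G e))) - oddLabel (inj₁ (proj₂ (edge G e))) ∣

  oddLabel-edge : ∀ e → oddLabel (inj₂ e) ≡ edgeDiff G g e * 2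
  oddLabel-edge e = sym (*-distribʳ-∣-∣ 2 (g (proj₁ (edge G e))) (g (proj₂ (edge G e))))

  top-label : 1 + V G + nE G ∸ 1 ≡ suc (q * 2)
  top-label = begin
    V G + q        ≡⟨ cong (_+ q) size ⟩
    suc (q + q)    ≡⟨ cong (λ x → suc (q + x)) (sym (+-identityʳ q)) ⟩
    suc (2 * q)    ≡⟨ cong suc (*-comm 2 q) ⟩
    suc (q * 2)    ∎
    where open ≡-Reasoning

  oddLabel-lower : ∀ x → 1 ≤ oddLabel x
  oddLabel-lower (inj₁ v) = s≤s z≤n
  oddLabel-lower (inj₂ e) =
    ≤-trans (edge-positive e) (≤-trans (m≤m*n _ 2) (≤-reflexive (sym (oddLabel-edge e))))

  oddLabel-upper : ∀ x → oddLabel x ≤ suc (q * 2)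
  oddLabel-upper (inj₁ v) = s≤s (*-monoˡ-≤ 2 (vertex-bound v))
  oddLabel-upper (inj₂ e) =
    ≤-trans (≤-reflexive (oddLabel-edge e)) (≤-trans (*-monoˡ-≤ 2 (edge-bound e)) (n≤1+n _))

  -- Vertex labels are odd and edge labels even, so the two never collide.
  oddLabel-injective : Injective _≡_ _≡_ oddLabel
  oddLabel-injective {inj₁ v} {inj₁ w} eq = cong inj₁ (vertex-injective (*-cancelʳ-≡ _ _ 2 (suc-injective eq)))
  oddLabel-injective {inj₂ e} {inj₂ f} eq =
    cong inj₂ (edge-injective (*-cancelʳ-≡ _ _ 2 (trans (sym (oddLabel-edge e)) (trans eq (oddLabel-edge f)))))
  oddLabel-injective {inj₁ v} {inj₂ e} eq =
    contradiction (trans (sym (oddLabel-edge e)) (sym eq)) (even≢odd′ (edgeDiff G g e) (g v))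
  oddLabel-injective {inj₂ e} {inj₁ v} eq =
    contradiction (trans (sym (oddLabel-edge e)) eq) (even≢odd′ (edgeDiff G g e) (g v))

  oddLabel-onto : ∀ j → 1 ≤ j → j ≤ suc (q * 2) → ∃ λ x → oddLabel x ≡ j
  oddLabel-onto j 1≤j j≤top with parity j
  ... | odd h with vertex-onto h (half-≤ (≤-trans (n≤1+n _) j≤top))
  ...   | v , gv≡h = inj₁ v , cong (λ x → suc (x * 2)) gv≡h
  oddLabel-onto _ () _ | even zero
  oddLabel-onto _ _ j≤top | even (suc h) with edge-onto (suc h) (s≤s z≤n) (half-≤ j≤top)
  ... | e , d≡ = inj₂ e , trans (oddLabel-edge e) (cong (_* 2) d≡)

  graceful⇒oddSuperGraceful : HasOddVertexSuperGraceful 1 G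
  graceful⇒oddSuperGraceful = oddLabel , record
    { edge-label = λ e → refl
    ; lower = oddLabel-lower
    ; upper = λ x → subst (oddLabel x ≤_) (sym top-label) (oddLabel-upper x)
    ; injective = oddLabel-injective
    ; surjective = λ j 1≤j j≤top → oddLabel-onto j 1≤j (subst (j ≤_) top-label j≤top)
    } , λ v → [m+kn]%n≡m%n 1 (g v) 2

data Position (n i : ℕ) : Set where
  on-cycle : i < n → Position n i
  on-path  : ∀ j → i ≡ n + j → Position n i

position : ∀ n i → Position n i
position n i with i <? n
... | yes i<n = on-cycle i<n
... | no i≮n = on-path (i ∸ n) (sym (m+[n∸m]≡n (≮⇒≥ i≮n)))

glue : ℕ → (ℕ → ℕ) → (ℕ → ℕ) → ℕ → ℕ
glue n c p i with i <? n
... | yes _ = c i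
... | no _ = p (i ∸ n)

glue-cycle : ∀ {n c p i} → i < n → glue n c p i ≡ c i
glue-cycle {n} {i = i} i<n with i <? n
... | yes _ = refl
... | no i≮n = contradiction i<n i≮n

glue-path : ∀ {n c p} j → glue n c p (n + j) ≡ p j
glue-path {n} {p = p} j with n + j <? n
... | yes n+j<n = contradiction n+j<n (m+n≮m n j)
... | no _ = cong p (m+n∸m≡n n j)

glue-all : ∀ {n c p} (P : ℕ → Set) → (∀ i → P (c i)) → (∀ j → P (p j)) → ∀ i → P (glue n c p i)
glue-all {n} P Pc Pp i with i <? n
... | yes _ = Pc i
... | no _ = Pp (i ∸ n)

-- The edges of C_n + P_m join each position k to next n k: around the cycle, then along
-- the path.
next : (n : ℕ) → .{{NonZero n}} → ℕ → ℕ
next n = glue n (λ k → suc k % n) (λ j → n + suc j)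

next-cycle : ∀ {n k} .{{_ : NonZero n}} → k < n → next n k ≡ suc k % n
next-cycle = glue-cycle

next-path : ∀ {n} .{{_ : NonZero n}} j → next n (n + j) ≡ n + suc j
next-path {n} = glue-path {n} {λ k → suc k % n}

diff : (n : ℕ) → .{{NonZero n}} → (ℕ → ℕ) → ℕ → ℕ
diff n lab k = ∣ lab k - lab (next n k) ∣

next-bound : ∀ {n t k} .{{_ : NonZero n}} → n ≤ t → k < t → next n k ≤ t
next-bound {n} {k = k} n≤t k<t with position n k
... | on-cycle k<n = ≤-trans (≤-reflexive (next-cycle k<n)) (<⇒≤ (<-≤-trans (m%n<n (suc k) n) n≤t))
... | on-path j refl = ≤-trans (≤-reflexive (trans (next-path j) (+-suc n j))) k<t

-- Graceful labeling of C_n + P_{t-n+1} by positions: every label in [0, t] is taken on the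
-- t + 1 positions and every difference in [1, t] on the t edges.  Phrased with bounded
-- quantifiers so that it is decidable.
record Graceful (n : ℕ) .{{_ : NonZero n}} (t : ℕ) (lab : ℕ → ℕ) : Set where
  field
    label-bound : ∀ {i} → i < suc t → lab i < suc t
    label-onto  : ∀ {y} → y < suc t → ∃ λ i → i < suc t × lab i ≡ y
    diff-onto   : ∀ {y} → y < t → ∃ λ k → k < t × diff n lab k ≡ suc y

graceful? : ∀ n .{{_ : NonZero n}} t lab → Dec (Graceful n t lab)
graceful? n t lab =
  map′ (λ (b , o , d) → record
          { label-bound = λ {i} → b {i} ; label-onto = λ {y} → o {y} ; diff-onto = λ {y} → d {y} })
       (λ gr → let open Graceful gr
               in (λ {i} → label-bound {i}) , (λ {y} → label-onto {y}) , (λ {y} → diff-onto {y}))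
       (allUpTo? (λ i → lab i <? suc t) (suc t)
        ×-dec allUpTo? (λ y → anyUpTo? (λ i → lab i ≟ y) (suc t)) (suc t)
        ×-dec allUpTo? (λ y → anyUpTo? (λ k → diff n lab k ≟ suc y) t) t)

-- Inserting three path vertices right after the cycle moves old position i to shift n i.
shift : ℕ → ℕ → ℕ
shift n = glue n (λ i → i) (λ j → n + (3 + j))

shift-cycle : ∀ {n i} → i < n → shift n i ≡ i
shift-cycle = glue-cycle

shift-path : ∀ {n} j → shift n (n + j) ≡ n + (3 + j)
shift-path {n} = glue-path {n} {λ i → i}

shift-≤ : ∀ n i → shift n i ≤ 3 + i
shift-≤ n i with position n i
... | on-cycle i<n = ≤-trans (≤-reflexive (shift-cycle i<n)) (m≤n+m i 3)
... | on-path j refl = ≤-reflexive (begin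
  shift n (n + j)  ≡⟨ shift-path j ⟩
  n + (3 + j)      ≡⟨ sym (+-assoc n 3 j) ⟩
  n + 3 + j        ≡⟨ cong (_+ j) (+-comm n 3) ⟩
  3 + (n + j)      ∎)
  where open ≡-Reasoning

next-shift : ∀ n .{{_ : NonZero n}} k → next n (shift n k) ≡ shift n (next n k)
next-shift n k with position n k
... | on-cycle k<n = begin
  next n (shift n k)   ≡⟨ cong (next n) (shift-cycle k<n) ⟩
  next n k             ≡⟨ next-cycle k<n ⟩
  suc k % n            ≡⟨ sym (shift-cycle (m%n<n (suc k) n)) ⟩
  shift n (suc k % n)  ≡⟨ cong (shift n) (sym (next-cycle k<n)) ⟩
  shift n (next n k)   ∎
  where open ≡-Reasoning
... | on-path j refl = begin
  next n (shift n (n + j))  ≡⟨ cong (next n) (shift-path j) ⟩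
  next n (n + (3 + j))      ≡⟨ next-path (3 + j) ⟩
  n + (3 + suc j)           ≡⟨ sym (shift-path (suc j)) ⟩
  shift n (n + suc j)       ≡⟨ cong (shift n) (sym (next-path j)) ⟩
  shift n (next n (n + j))  ∎
  where open ≡-Reasoning

reflect-dist : ∀ {c a b} → a ≤ c → b ≤ c → ∣ (c ∸ a) - (c ∸ b) ∣ ≡ ∣ a - b ∣
reflect-dist {c} {zero} {b} _ b≤c = trans (m≤n⇒∣n-m∣≡n∸m (m∸n≤m c b)) (m∸[m∸n]≡n b≤c)
reflect-dist {c} {suc a} {zero} a≤c _ =
  trans (∣-∣-comm (c ∸ suc a) c) (trans (m≤n⇒∣n-m∣≡n∸m (m∸n≤m c (suc a))) (m∸[m∸n]≡n a≤c))
reflect-dist {suc c} {suc a} {suc b} (s≤s a≤c) (s≤s b≤c) = reflect-dist a≤c b≤c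

module Extension (n : ℕ) .{{_ : NonZero n}} (t : ℕ) (n≤t : n ≤ t) (lab : ℕ → ℕ)
                 (starts : lab n ≡ 1) (gr : Graceful n t lab) where
  open Graceful gr

  reflect : ℕ → ℕ
  reflect x = suc (suc t) ∸ x

  reflect-bound : ∀ x → reflect x ≤ 3 + t
  reflect-bound x = ≤-trans (m∸n≤m (suc (suc t)) x) (n≤1+n _)

  newPath : ℕ → ℕ
  newPath 0 = 1
  newPath 1 = 3 + t
  newPath 2 = 0
  newPath (suc (suc (suc j))) = reflect (lab (n + j))

  extended : ℕ → ℕ
  extended = glue n (λ i → reflect (lab i)) newPath

  extended-new : ∀ j → extended (n + j) ≡ newPath j
  extended-new = glue-path {n} {λ i → reflect (lab i)}

  extended-shift : ∀ o → extended (shift n o) ≡ reflect (lab o)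
  extended-shift o with position n o
  ... | on-cycle o<n = trans (cong extended (shift-cycle o<n)) (glue-cycle o<n)
  ... | on-path j refl = trans (cong extended (shift-path j)) (extended-new (3 + j))

  extended-bound : ∀ i → extended i ≤ 3 + t
  extended-bound = glue-all {n} (_≤ 3 + t) (λ i → reflect-bound (lab i)) newPath-bound
    where
      newPath-bound : ∀ j → newPath j ≤ 3 + t
      newPath-bound 0 = s≤s z≤n
      newPath-bound 1 = ≤-refl
      newPath-bound 2 = z≤n
      newPath-bound (suc (suc (suc j))) = reflect-bound (lab (n + j))

  lab-≤ : ∀ {i} → i ≤ t → lab i ≤ suc (suc t)
  lab-≤ i≤t = ≤-trans (s≤s⁻¹ (label-bound (s≤s i≤t))) (≤-trans (n≤1+n t) (n≤1+n (suc t)))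

  new-position : ∀ {j} → j ≤ 2 → n + j < 3 + t
  new-position j≤2 = s≤s (≤-trans (+-mono-≤ n≤t j≤2) (≤-reflexive (+-comm t 2)))

  diff-shift : ∀ {k} → k < t → diff n extended (shift n k) ≡ diff n lab k
  diff-shift {k} k<t = begin
    ∣ extended (shift n k) - extended (next n (shift n k)) ∣
      ≡⟨ cong (λ x → ∣ extended (shift n k) - extended x ∣) (next-shift n k) ⟩
    ∣ extended (shift n k) - extended (shift n (next n k)) ∣
      ≡⟨ cong₂ ∣_-_∣ (extended-shift k) (extended-shift (next n k)) ⟩
    ∣ reflect (lab k) - reflect (lab (next n k)) ∣
      ≡⟨ reflect-dist (lab-≤ (<⇒≤ k<t)) (lab-≤ (next-bound n≤t k<t)) ⟩
    ∣ lab k - lab (next n k) ∣ ∎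
    where open ≡-Reasoning

  -- the differences t + 2, t + 3, t + 1 of the three new edges
  diff-new : ∀ j → diff n extended (n + j) ≡ ∣ newPath j - newPath (suc j) ∣
  diff-new j = trans (cong (λ x → ∣ extended (n + j) - extended x ∣) (next-path j))
                     (cong₂ ∣_-_∣ (extended-new j) (extended-new (suc j)))

  diff-new₂ : diff n extended (n + 2) ≡ suc t
  diff-new₂ = trans (diff-new 2) (cong reflect (trans (cong lab (+-identityʳ n)) starts))

  extended-onto : ∀ {y} → y < suc (3 + t) → ∃ λ i → i < suc (3 + t) × extended i ≡ y
  extended-onto {0} _ = n + 2 , m<n⇒m<1+n (new-position ≤-refl) , extended-new 2
  extended-onto {1} _ = n + 0 , m<n⇒m<1+n (new-position z≤n) , extended-new 0
  extended-onto {suc (suc y)} (s≤s (s≤s (s≤s y≤1+t))) with m≤n⇒m<n∨m≡n y≤1+t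
  ... | inj₂ refl = n + 1 , m<n⇒m<1+n (new-position (s≤s z≤n)) , extended-new 1
  ... | inj₁ (s≤s y≤t) with label-onto {t ∸ y} (s≤s (m∸n≤m t y))
  ...   | o , o<1+t , lab-o = shift n o , s≤s (≤-trans (shift-≤ n o) (+-monoʳ-≤ 3 (s≤s⁻¹ o<1+t))) ,
          trans (extended-shift o) (trans (cong reflect lab-o) (m∸[m∸n]≡n (s≤s (s≤s y≤t))))

  extended-diff-onto : ∀ {y} → y < 3 + t → ∃ λ k → k < 3 + t × diff n extended k ≡ suc y
  extended-diff-onto {y} (s≤s y≤2+t) with m≤n⇒m<n∨m≡n y≤2+t
  ... | inj₂ refl = n + 1 , new-position (s≤s z≤n) , diff-new 1
  ... | inj₁ (s≤s y≤1+t) with m≤n⇒m<n∨m≡n y≤1+t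
  ...   | inj₂ refl = n + 0 , new-position z≤n , diff-new 0
  ...   | inj₁ (s≤s y≤t) with m≤n⇒m<n∨m≡n y≤t
  ...     | inj₂ refl = n + 2 , new-position ≤-refl , diff-new₂
  ...     | inj₁ y<t with diff-onto y<t
  ...       | k , k<t , diff-k = shift n k , ≤-<-trans (shift-≤ n k) (+-monoʳ-< 3 k<t) ,
              trans (diff-shift k<t) diff-k

  extension : Graceful n (3 + t) extended
  extension = record
    { label-bound = λ {i} _ → s≤s (extended-bound i)
    ; label-onto = extended-onto
    ; diff-onto = extended-diff-onto
    }

  extension-starts : extended n ≡ 1
  extension-starts = trans (cong extended (sym (+-identityʳ n))) (extended-new 0)

Startable : (n : ℕ) → .{{NonZero n}} → ℕ → Set
Startable n t = Σ (ℕ → ℕ) λ lab → Graceful n t lab × lab n ≡ 1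

startable-step : ∀ {n t} .{{_ : NonZero n}} → n ≤ t → Startable n t → Startable n (3 + t)
startable-step {n} {t} n≤t (lab , gr , starts) = extended , extension , extension-starts
  where open Extension n t n≤t lab starts gr

startable-from : ∀ {n} .{{_ : NonZero n}} t₀ → n ≤ t₀ →
                 Startable n t₀ → Startable n (1 + t₀) → Startable n (2 + t₀) →
                 ∀ k → Startable n (t₀ + k)
startable-from {n} t₀ n≤t₀ s₀ s₁ s₂ k = subst (Startable n) (+-comm k t₀) (from k)
  where
    from : ∀ k → Startable n (k + t₀)
    from 0 = s₀
    from 1 = s₁
    from 2 = s₂
    from (suc (suc (suc k))) = startable-step (≤-trans n≤t₀ (m≤n+m t₀ k)) (from k)

lookup-++-split : ∀ {A : Set} (xs ys : List A) (e : Fin (length (xs ++ ys))) →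
  (∃ λ (i : Fin (length xs)) → toℕ e ≡ toℕ i × lookup (xs ++ ys) e ≡ lookup xs i) ⊎
  (∃ λ (j : Fin (length ys)) → toℕ e ≡ length xs + toℕ j × lookup (xs ++ ys) e ≡ lookup ys j)
lookup-++-split [] ys e = inj₂ (e , refl , refl)
lookup-++-split (x ∷ xs) ys Fin.zero = inj₁ (Fin.zero , refl , refl)
lookup-++-split (x ∷ xs) ys (Fin.suc e) with lookup-++-split xs ys e
... | inj₁ (i , e≡i , at) = inj₁ (Fin.suc i , cong suc e≡i , at)
... | inj₂ (j , e≡j , at) = inj₂ (j , cong suc e≡j , at)

lookup-map-tabulate : ∀ {A B : Set} {k} (F : A → B) (g : Fin k → A) (e : Fin (length (map F (tabulate g)))) →
  ∃ λ i → toℕ e ≡ toℕ i × lookup (map F (tabulate g)) e ≡ F (g i)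
lookup-map-tabulate {k = suc k} F g Fin.zero = Fin.zero , refl , refl
lookup-map-tabulate {k = suc k} F g (Fin.suc e) with lookup-map-tabulate F (λ i → g (Fin.suc i)) e
... | i , e≡i , at = Fin.suc i , cong suc e≡i , at

length-map-tabulate : ∀ {A B : Set} {k} (F : A → B) (g : Fin k → A) → length (map F (tabulate g)) ≡ k
length-map-tabulate F g = trans (length-map F (tabulate g)) (length-tabulate g)

module _ (n : ℕ) .{{_ : NonZero n}} (m : ℕ) where
  private
    G = cycle n ⊕ path (suc m)

    cycleEdge : Fin n → Fin n × Fin n
    cycleEdge i = (i , suc (toℕ i) mod n)
    pathEdge : Fin m → Fin (suc m) × Fin (suc m)
    pathEdge j = (inject₁ j , Fin.suc j)
    liftˡ : Fin n × Fin n → Fin (n + suc m) × Fin (n + suc m)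
    liftˡ (u , v) = (u ↑ˡ suc m , v ↑ˡ suc m)
    liftʳ : Fin (suc m) × Fin (suc m) → Fin (n + suc m) × Fin (n + suc m)
    liftʳ (u , v) = (n ↑ʳ u , n ↑ʳ v)

    cycleEdges = map liftˡ (tabulate cycleEdge)
    pathEdges = map liftʳ (tabulate pathEdge)

  edge-count : nE G ≡ n + m
  edge-count = trans (length-++ cycleEdges) (cong₂ _+_ (length-map-tabulate liftˡ cycleEdge)
                                                      (length-map-tabulate liftʳ pathEdge))

  record ChainEdge (e : Fin (nE G)) : Set where
    field
      index-bound : toℕ e < n + m
      source : toℕ (proj₁ (edge G e)) ≡ toℕ e
      target : toℕ (proj₂ (edge G e)) ≡ next n (toℕ e)

  chain-edge : ∀ e → ChainEdge e
  chain-edge e with lookup-++-split cycleEdges pathEdges e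
  ... | inj₁ (i , e≡i , at) with lookup-map-tabulate liftˡ cycleEdge i
  ...   | c , i≡c , at′ = record
          { index-bound = subst (_< n + m) (sym e≡c) (≤-trans (toℕ<n c) (m≤m+n n m))
          ; source = trans (cong (toℕ ∘ proj₁) edge≡) (trans (toℕ-↑ˡ c (suc m)) (sym e≡c))
          ; target = trans (cong (toℕ ∘ proj₂) edge≡)
              (trans (toℕ-↑ˡ _ (suc m)) (trans (toℕ-fromℕ< _)
                (trans (sym (next-cycle (toℕ<n c))) (cong (next n) (sym e≡c)))))
          }
    where
      e≡c = trans e≡i i≡c
      edge≡ = trans at at′
  chain-edge e | inj₂ (j , e≡j , at) with lookup-map-tabulate liftʳ pathEdge j
  ...   | p , j≡p , at′ = record
          { index-bound = subst (_< n + m) (sym e≡n+p) (+-monoʳ-< n (toℕ<n p))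
          ; source = trans (cong (toℕ ∘ proj₁) edge≡)
              (trans (toℕ-↑ʳ n (inject₁ p)) (trans (cong (n +_) (toℕ-inject₁ p)) (sym e≡n+p)))
          ; target = trans (cong (toℕ ∘ proj₂) edge≡)
              (trans (toℕ-↑ʳ n (Fin.suc p)) (trans (sym (next-path (toℕ p))) (cong (next n) (sym e≡n+p))))
          }
    where
      e≡n+p = trans e≡j (cong₂ _+_ (length-map-tabulate liftˡ cycleEdge) j≡p)
      edge≡ = trans at at′

  diff-chain : ∀ lab e → edgeDiff G (lab ∘ toℕ) e ≡ diff n lab (toℕ e)
  diff-chain lab e = cong₂ (λ u v → ∣ lab u - lab v ∣) source target
    where open ChainEdge (chain-edge e)

  chain⇒graceful : ∀ lab → Graceful n (n + m) lab → IsGraceful G (lab ∘ toℕ)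
  chain⇒graceful lab gr = record
    { vertex-bound = λ v → subst (lab (toℕ v) ≤_) (sym edge-count) (s≤s⁻¹ (label-bound (position< v)))
    ; vertex-onto = vertex-onto
    ; edge-onto = edge-onto
    }
    where
      open Graceful gr

      position< : (v : Fin (n + suc m)) → toℕ v < suc (n + m)
      position< v = subst (toℕ v <_) (+-suc n m) (toℕ<n v)

      vertex-onto : ∀ y → y ≤ nE G → ∃ λ v → lab (toℕ v) ≡ y
      vertex-onto y y≤q with label-onto (s≤s (subst (y ≤_) edge-count y≤q))
      ... | i , i<1+t , lab-i = fromℕ< (subst (i <_) (sym (+-suc n m)) i<1+t) ,
                                trans (cong lab (toℕ-fromℕ< _)) lab-i

      edge-onto : ∀ y → 1 ≤ y → y ≤ nE G → ∃ λ e → edgeDiff G (lab ∘ toℕ) e ≡ y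
      edge-onto (suc y) _ y<q with diff-onto (subst (y <_) edge-count y<q)
      ... | k , k<t , diff-k = e , trans (diff-chain lab e) (trans (cong (diff n lab) (toℕ-fromℕ< _)) diff-k)
        where e = fromℕ< (subst (k <_) (sym edge-count) k<t)

  -- C_n + P_{m+1} has n + m + 1 = q + 1 vertices, so the doubling applies.
  chain⇒oddSuperGraceful : ∀ lab → Graceful n (n + m) lab → HasOddVertexSuperGraceful 1 G
  chain⇒oddSuperGraceful lab gr =
    graceful⇒oddSuperGraceful G (trans (+-suc n m) (cong suc (sym edge-count)))
                              (lab ∘ toℕ) (chain⇒graceful lab gr)

-- Explicit small labelings by positions (values beyond the list are irrelevant).
listed : List ℕ → ℕ → ℕ
listed [] _ = 0
listed (x ∷ xs) zero = x
listed (x ∷ xs) (suc i) = listed xs i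

by-computation : ∀ n .{{_ : NonZero n}} t lab {_ : True (graceful? n t lab)} → Graceful n t lab
by-computation n t lab {ok} = toWitness ok

-- C_3 + P_m for m = 4, 5, 6, 9 (sizes 6, 7, 8, 11); all but C3P6 start the path with label 1
C3P4 C3P5 C3P6 C3P9 : ℕ → ℕ
C3P4 = listed (2 ∷ 3 ∷ 5 ∷ 1 ∷ 6 ∷ 0 ∷ 4 ∷ [])
C3P5 = listed (2 ∷ 4 ∷ 5 ∷ 1 ∷ 6 ∷ 0 ∷ 7 ∷ 3 ∷ [])
C3P6 = listed (2 ∷ 3 ∷ 5 ∷ 4 ∷ 8 ∷ 0 ∷ 7 ∷ 1 ∷ 6 ∷ [])
C3P9 = listed (4 ∷ 6 ∷ 7 ∷ 1 ∷ 10 ∷ 0 ∷ 11 ∷ 3 ∷ 8 ∷ 2 ∷ 9 ∷ 5 ∷ [])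

-- C_4 + P_m for m = 3, 4, 5 (sizes 6, 7, 8), each starting the path with label 1
C4P3 C4P4 C4P5 : ℕ → ℕ
C4P3 = listed (0 ∷ 5 ∷ 2 ∷ 6 ∷ 1 ∷ 3 ∷ 4 ∷ [])
C4P4 = listed (0 ∷ 6 ∷ 2 ∷ 7 ∷ 1 ∷ 4 ∷ 3 ∷ 5 ∷ [])
C4P5 = listed (0 ∷ 7 ∷ 2 ∷ 8 ∷ 1 ∷ 5 ∷ 4 ∷ 6 ∷ 3 ∷ [])

-- sizes 9, 10, 11: two extensions of the sizes 6, 7, and one explicit labeling
C3-startable : ∀ k → Startable 3 (9 + k)
C3-startable = startable-from 9 (m≤m+n 3 6)
  (startable-step (m≤m+n 3 3) (C3P4 , by-computation 3 6 C3P4 , refl))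
  (startable-step (m≤m+n 3 4) (C3P5 , by-computation 3 7 C3P5 , refl))
  (C3P9 , by-computation 3 11 C3P9 , refl)

-- sizes 6, 7, 8 explicitly (size 8 has no labeling starting the path with 1), then as above
C3-graceful : ∀ k → ∃ λ lab → Graceful 3 (6 + k) lab
C3-graceful 0 = C3P4 , by-computation 3 6 C3P4
C3-graceful 1 = C3P5 , by-computation 3 7 C3P5
C3-graceful 2 = C3P6 , by-computation 3 8 C3P6
C3-graceful (suc (suc (suc k))) = let (lab , gr , _) = C3-startable k in lab , gr

C4-startable : ∀ k → Startable 4 (6 + k)
C4-startable = startable-from 6 (m≤m+n 4 2)
  (C4P3 , by-computation 4 6 C4P3 , refl)
  (C4P4 , by-computation 4 7 C4P4 , refl)
  (C4P5 , by-computation 4 8 C4P5 , refl)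

-- C_n + P_m has q = n + m - 1 = 6 + k edges, where k = m - 4 for n = 3 and k = m - 3 for n = 4.
theorem4p10 : (∀ (m : ℕ) → 4 ≤ m → HasOddVertexSuperGraceful 1 (cycle 3 ⊕ path m))
    × (∀ (m : ℕ) → 3 ≤ m → HasOddVertexSuperGraceful 1 (cycle 4 ⊕ path m))
theorem4p10 = triangle , square
  where
    triangle : ∀ (m : ℕ) → 4 ≤ m → HasOddVertexSuperGraceful 1 (cycle 3 ⊕ path m)
    triangle 1 (s≤s ())
    triangle 2 (s≤s (s≤s ()))
    triangle 3 (s≤s (s≤s (s≤s ())))
    triangle (suc (suc (suc (suc k)))) _ =
      let (lab , gr) = C3-graceful k in chain⇒oddSuperGraceful 3 (3 + k) lab gr

    square : ∀ (m : ℕ) → 3 ≤ m → HasOddVertexSuperGraceful 1 (cycle 4 ⊕ path m)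
    square 1 (s≤s ())
    square 2 (s≤s (s≤s ()))
    square (suc (suc (suc k))) _ =
      let (lab , gr , _) = C4-startable k in chain⇒oddSuperGraceful 4 (2 + k) lab gr
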